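{- Let $(\varepsilon,\lessdot)$ be a prioritized Extended Bundle Event Structure with $\varepsilon=(E,\leadsto,\mapsto,l)$, and let $\lessdot'=\lessdot\setminus\{(e,e')\mid e'\leadsto e\vee(\exists X\subseteq E.\ (e\in X\wedge X\mapsto e')\vee(e'\in X\wedge X\mapsto e))\}$. Then $\mathrm{Traces}(\varepsilon,\lessdot)=\mathrm{Traces}(\varepsilon,\lessdot')$.
   Context: An Extended Bundle Event Structure (EBES) is a quadruple $\varepsilon=(E,\leadsto,\mapsto,l)$ where $E$ is a set of events, $\leadsto\subseteq E\times E$ is an irreflexive relation (disabling; $e\leadsto e'$ means that once $e'$ has occurred, $e$ can no longer occur), $\mapsto\subseteq\mathcal{P}(E)\times E$ is the enabling relation (a pair $(X,e)$ is written $X\mapsto e$), and $l:E\to Act$ is a labeling function, satisfying Stability: whenever $X\mapsto e$, any two distinct $e_1,e_2\in X$ satisfy $e_1\leadsto e_2$. For a finite sequence $\sigma=e_1\cdots e_n$ write $\bar\sigma=\{e_1,\dots,e_n\}$, $\sigma_i=e_1\cdots e_i$ ($\sigma_0$ empty), and $\mathrm{en}_\varepsilon(\sigma)=\{e\in E\setminus\bar\sigma\mid(\forall X\subseteq E.\ X\mapsto e\Rightarrow X\cap\bar\sigma\neq\emptyset)\wedge\neg\exists e'\in\bar\sigma.\ e\leadsto e'\}$. $\sigma$ is a trace of $\varepsilon$ iff $e_i\in\mathrm{en}_\varepsilon(\sigma_{i-1})$ for all $1\le i\le n$. A prioritized EBES (PEBES) is a pair $(\varepsilon,\lessdot)$ with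 $\lessdot\subseteq E\times E$ acyclic ($e\lessdot e'$: $e'$ has higher priority). $\sigma=e_1\cdots e_n$ is a trace of $(\varepsilon,\lessdot)$ iff $\sigma$ is a trace of $\varepsilon$ and for all $0\le i<n$ and all $e_j,e_h\in\bar\sigma$ with $e_j\neq e_h$, $e_j,e_h\in\mathrm{en}_\varepsilon(\sigma_i)$ and $e_h\lessdot e_j$, we have $j<h$; $\mathrm{Traces}(\varepsilon,\lessdot)$ is the set of these traces (same for subrelations of $\lessdot$). -}

module Defs where

open import Level using (Level; suc; _⊔_) renaming (zero to 0ℓ)
open import Data.Nat using (ℕ; _<_)
open import Data.Fin using (Fin; toℕ)
open import Data.List using (List; length; take; lookup)
open import Data.List.Membership.Propositional using (_∈_; _∉_)
open import Data.List.Relation.Unary.Any using (Any)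
open import Data.Product using (Σ; ∃; _×_)
open import Data.Sum using (_⊎_)
open import Relation.Nullary using (¬_)
open import Relation.Binary.PropositionalEquality using (_≡_; _≢_)
open import Relation.Binary.Construct.Closure.Transitive using (TransClosure)

Subset : Set → Set₁
Subset E = E → Set

record EBES (Act : Set) : Set₁ where
  field
    E      : Set
    _⇝_    : E → E → Set
    _↦_    : Subset E → E → Set
    l      : E → Act
    ⇝-irrefl  : ∀ e → ¬ (e ⇝ e)
    stability : ∀ (X : Subset E) e → X ↦ e →
                ∀ e₁ e₂ → X e₁ → X e₂ → e₁ ≢ e₂ → e₁ ⇝ e₂

module _ {Act : Set} (ε : EBES Act) where
  open EBES ε

  -- e ∈ en_ε(σ), σ a finite sequence of events (list, first event first)
  Enabled : List E → E → Set₁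
  Enabled σ e =
    e ∉ σ ×
    (∀ (X : Subset E) → X ↦ e → Σ E (λ e' → X e' × e' ∈ σ)) ×
    ¬ (Σ E (λ e' → e' ∈ σ × e ⇝ e'))

  -- σ is a trace of ε: e_i ∈ en(σ_{i-1}) for all i (0-based here)
  IsTrace : List E → Set₁
  IsTrace σ = ∀ (i : Fin (length σ)) → Enabled (take (toℕ i) σ) (lookup σ i)

  -- σ is a trace of (ε, ≺) where e ≺ e' means e' has higher priority.
  -- Positions j, h are 0-based (the paper's indices shifted by one);
  -- i ranges over 0 ≤ i < n.
  IsPTrace : ∀ {ℓ} → (E → E → Set ℓ) → List E → Set (suc 0ℓ ⊔ ℓ)
  IsPTrace _≺_ σ =
    IsTrace σ ×
    (∀ (i : Fin (length σ)) (j h : Fin (length σ)) →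
       lookup σ j ≢ lookup σ h →
       Enabled (take (toℕ i) σ) (lookup σ j) →
       Enabled (take (toℕ i) σ) (lookup σ h) →
       lookup σ h ≺ lookup σ j →
       toℕ j < toℕ h)

  Acyclic : ∀ {ℓ} → (E → E → Set ℓ) → Set ℓ
  Acyclic _≺_ = ∀ e → ¬ TransClosure _≺_ e e

  reducedPriority : (E → E → Set) → E → E → Set₁
  reducedPriority _≺_ e e' =
    e ≺ e' ×
    ¬ (e' ⇝ e ⊎ Σ (Subset E) (λ X → (X e × X ↦ e') ⊎ (X e' × X ↦ e)))

-- Removing a pair from the priority relation changes no trace as long as
-- that pair can never be simultaneously enabled with the lower event
-- occurring later.  Pairs in a bundle relation are never enabled together:
-- enabling the target needs a bundle member e' in the prefix, and stability
-- makes every other member disabled by e'.  A pair e ⋖ e' with e' ⇝ e can be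
-- enabled together, but then e' cannot follow e in a trace, so the priority
-- constraint on it holds anyway.
module Submission where

open import Defs
open import Data.List using (List; _∷_; length; take; lookup)
open import Data.List.Membership.Propositional using (_∈_)
open import Data.List.Relation.Unary.Any using (here; there)
open import Data.Fin using (Fin; zero; suc; toℕ)
open import Data.Fin.Properties using (toℕ-injective)
open import Data.Nat using (_<_; s≤s)
open import Data.Nat.Properties using (_<?_; ≮⇒≥; ≤∧≢⇒<)
open import Data.Product using (Σ; _×_; _,_; proj₁)
open import Data.Sum using (_⊎_; inj₁; inj₂)
open import Function.Bundles using (_⇔_; mk⇔)
open import Relation.Nullary using (¬_; yes; no)
open import Relation.Binary.PropositionalEquality using (_≢_; refl; cong; sym; subst)

lookup∈take : ∀ {A : Set} (xs : List A) (i j : Fin (length xs)) →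
              toℕ i < toℕ j → lookup xs i ∈ take (toℕ j) xs
lookup∈take (x ∷ xs) zero    (suc j) _       = here refl
lookup∈take (x ∷ xs) (suc i) (suc j) (s≤s p) = there (lookup∈take xs i j p)

module _ {Act : Set} (ε : EBES Act) where
  open EBES ε

  Excluded : E → E → Set₁
  Excluded e e' = e' ⇝ e ⊎ Σ (Subset E) (λ X → (X e × X ↦ e') ⊎ (X e' × X ↦ e))

  IsPTrace-antitone : ∀ {ℓ ℓ'} (_≺_ : E → E → Set ℓ) (_≺'_ : E → E → Set ℓ') →
                      (∀ {e e'} → e ≺' e' → e ≺ e') →
                      ∀ {σ} → IsPTrace ε _≺_ σ → IsPTrace ε _≺'_ σ
  IsPTrace-antitone _ _ ≺'⇒≺ (tr , prio) =
    tr , λ i j h ne ej eh r → prio i j h ne ej eh (≺'⇒≺ r)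

  enabled-∉-bundle : ∀ {ρ e e'} (X : Subset E) →
                     Enabled ε ρ e → Enabled ε ρ e' → X e → ¬ X ↦ e'
  enabled-∉-bundle {ρ} {e} X (e∉ρ , _ , e-live) (_ , e'-bundles , _) Xe X↦e'
    with e'-bundles X X↦e'
  ... | x , Xx , x∈ρ = e-live (x , x∈ρ , stability X _ X↦e' e x Xe Xx e≢x)
    where
    e≢x : e ≢ x
    e≢x e≡x = e∉ρ (subst (_∈ ρ) (sym e≡x) x∈ρ)

  trace-earlier-¬disables : ∀ {σ} → IsTrace ε σ → ∀ h j →
                            toℕ h < toℕ j → ¬ lookup σ j ⇝ lookup σ h
  trace-earlier-¬disables {σ} tr h j h<j d with tr j
  ... | _ , _ , j-live = j-live (lookup σ h , lookup∈take σ h j h<j , d)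

  ¬excluded : ∀ {σ} → IsTrace ε σ → ∀ {ρ} h j → toℕ h < toℕ j →
               Enabled ε ρ (lookup σ h) → Enabled ε ρ (lookup σ j) →
               ¬ Excluded (lookup σ h) (lookup σ j)
  ¬excluded tr h j h<j _  _  (inj₁ d)                       = trace-earlier-¬disables tr h j h<j d
  ¬excluded _  _ _ _   eh ej (inj₂ (X , inj₁ (Xh , X↦j))) = enabled-∉-bundle X eh ej Xh X↦j
  ¬excluded _  _ _ _   eh ej (inj₂ (X , inj₂ (Xj , X↦h))) = enabled-∉-bundle X ej eh Xj X↦h

  reducedPriority⇒IsPTrace : ∀ (_⋖_ : E → E → Set) {σ} →
                             IsPTrace ε (reducedPriority ε _⋖_) σ → IsPTrace ε _⋖_ σ
  reducedPriority⇒IsPTrace _⋖_ {σ} (tr , prio) = tr , prio′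
    where
    prio′ : ∀ i j h → lookup σ j ≢ lookup σ h →
            Enabled ε (take (toℕ i) σ) (lookup σ j) →
            Enabled ε (take (toℕ i) σ) (lookup σ h) →
            lookup σ h ⋖ lookup σ j → toℕ j < toℕ h
    prio′ i j h ne ej eh h⋖j with toℕ j <? toℕ h
    ... | yes j<h = j<h
    ... | no j≮h  = prio i j h ne ej eh (h⋖j , ¬excluded tr h j h<j eh ej)
      where
      h<j : toℕ h < toℕ j
      h<j = ≤∧≢⇒< (≮⇒≥ j≮h) (λ h≡j → ne (cong (lookup σ) (sym (toℕ-injective h≡j))))

theorem6 : {Act : Set} (ε : EBES Act) (_⋖_ : EBES.E ε → EBES.E ε → Set) →
           Acyclic ε _⋖_ →
           ∀ (σ : List (EBES.E ε)) →
           IsPTrace ε _⋖_ σ ⇔ IsPTrace ε (reducedPriority ε _⋖_) σ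
theorem6 ε _⋖_ _ σ =
  mk⇔ (IsPTrace-antitone ε _⋖_ (reducedPriority ε _⋖_) proj₁) (reducedPriority⇒IsPTrace ε _⋖_)
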